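{- Let $t\ge1$, $n=2t^2+2t+1$, let $\mathcal{C}_0\subseteq\mathbb{Z}_n^2$ be a linear $t$-error-correcting perfect code with generator matrix $[a~~b]$, and let $\mathcal{C}=\mathbf{x}+\mathcal{C}_0$ for some $\mathbf{x}=(x_1,x_2)\in\mathbb{Z}_n^2$. Let $\mathcal{S}$ be the set of perfect Sudoku grids with respect to $\mathcal{C}$, $\bar{\mathcal{S}}$ the set of relabeling classes of $\mathcal{S}$, and \[ \mathcal{G}_\mathcal{S}=\langle \tau_2^{x_1+x_2+1}\tau_1^{x_1-x_2}r,\ \tau_1^a\tau_2^b\rangle, \] acting on $\bar{\mathcal{S}}$ by $g\cdot[S]=[g(S)]$. Then each equivalence class (orbit) in $\bar{\mathcal{S}}$ under the action of $\mathcal{G}_\mathcal{S}$ has size dividing $4n$.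
   Context: $\mathbb{Z}_n$ is the ring of integers modulo $n$; the Lee weight of $\mathbf{u}=(u_1,u_2)\in\mathbb{Z}_n^2$ (entries in $\{0,\dots,n-1\}$) is $\sum_i\min\{u_i,n-u_i\}$ and the Lee distance is $d_L(\mathbf{u},\mathbf{v})=\mathrm{wt}_L(\mathbf{u}-\mathbf{v})$. A code is a subset of $\mathbb{Z}_n^2$, linear if a submodule; the code with generator matrix $[a~~b]$ is $\{k(a,b):k\in\mathbb{Z}_n\}$. $\mathcal{B}_t(\mathbf{c})$ is the set of points at Lee distance $\le t$ from $\mathbf{c}$. A $t$-error-correcting perfect code is a code of minimum Lee distance $2t+1$ whose balls $\mathcal{B}_t(\mathbf{c})$ partition $\mathbb{Z}_n^2$; then $|\mathcal{C}|=n$. For $\mathcal{C}=\{\mathbf{c}_1,\dots,\mathbf{c}_n\}$ the palette grid $\mathcal{I}_\mathcal{C}$ is the $n\times n$ array (rows/columns indexed by $0,\dots,n-1$) with entry $i$ at every $(x,y)\in\mathcal{B}_t(\mathbf{c}_i)$. Two $n\times n$ arrays over $[n]=\{1,\dots,n\}$ are orthogonal if the ordered pairs of corresponding entries are pairwise distinct. A perfect Sudoku grid with respect to $\mathcal{C}$ is a Latin square over $[n]$ orthogonal to $\mathcal{I}_\mathcal{C}$. Relabeling: $S_1\sim S_2$ if there is a bijection $\sigma:[n]\to[n]$ with $\sigma((S_1)_{i,j})=(S_2)_{i,j}$ for all $i,j$; $[S]$ is the class of $S$. On $n\times n$ arrays (indices mod $n$): $(r(A))_{i,j}=A_{n-1-j,i}$,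 $(\tau_1(A))_{i,j}=A_{i-1,j}$, $(\tau_2(A))_{i,j}=A_{i,j-1}$; products denote composition. (It is known that $\mathcal{G}_\mathcal{S}$ maps $\mathcal{S}$ into $\mathcal{S}$, so the action is well defined.) -}

module Defs where

open import Data.Nat using (ℕ; zero; suc; _+_; _*_; _∸_; _≤_; _≤?_; NonZero; _⊓_)
open import Data.Nat.DivMod using (_mod_)
open import Data.Fin using (Fin; toℕ)
open import Data.Fin.Properties using (any?)
open import Data.Product using (_×_; _,_; ∃; Σ; proj₁)
open import Data.List using (List)
open import Data.List.Relation.Unary.All using (All)
open import Data.List.Relation.Unary.Any using (Any)
open import Data.List.Relation.Unary.AllPairs using (AllPairs)
open import Function.Bundles using (_↔_; Inverse)
open import Relation.Binary.PropositionalEquality using (_≡_)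
open import Relation.Nullary using (¬_; yes; no)

module _ (n : ℕ) .{{_ : NonZero n}} where

  Zn : Set
  Zn = Fin n

  _⊕_ : Zn → Zn → Zn
  u ⊕ v = (toℕ u + toℕ v) mod n

  ⊖_ : Zn → Zn
  ⊖ u = (n ∸ toℕ u) mod n

  _⊝_ : Zn → Zn → Zn
  u ⊝ v = u ⊕ (⊖ v)

  _⊛_ : Zn → Zn → Zn
  u ⊛ v = (toℕ u * toℕ v) mod n

  one : Zn
  one = 1 mod n

  Pt : Set
  Pt = Zn × Zn

  _+ᵖ_ : Pt → Pt → Pt
  (u₁ , u₂) +ᵖ (v₁ , v₂) = (u₁ ⊕ v₁ , u₂ ⊕ v₂)

  _·ᵖ_ : Zn → Pt → Pt
  k ·ᵖ (a , b) = (k ⊛ a , k ⊛ b)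

  wtL₁ : Zn → ℕ
  wtL₁ u = toℕ u ⊓ (n ∸ toℕ u)

  wtL : Pt → ℕ
  wtL (u₁ , u₂) = wtL₁ u₁ + wtL₁ u₂

  dL : Pt → Pt → ℕ
  dL (u₁ , u₂) (v₁ , v₂) = wtL (u₁ ⊝ v₁ , u₂ ⊝ v₂)

  InLinCode : Zn → Zn → Pt → Set
  InLinCode a b c = ∃ λ (k : Zn) → c ≡ k ·ᵖ (a , b)

  IsPerfectCode : ℕ → (Pt → Set) → Set
  IsPerfectCode t C =
      (∀ c c′ → C c → C c′ → ¬ c ≡ c′ → 2 * t + 1 ≤ dL c c′)
    × (∃ λ c → ∃ λ c′ → C c × C c′ × ¬ c ≡ c′ × dL c c′ ≡ 2 * t + 1)
    × (∀ p → ∃ λ c → C c × dL p c ≤ t)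
    × (∀ p c c′ → C c → C c′ → dL p c ≤ t → dL p c′ ≤ t → c ≡ c′)

  Array : Set
  Array = Zn → Zn → Fin n

  palette : ℕ → Zn → Zn → Pt → Array
  palette t a b x i j with any? (λ k → dL (i , j) (x +ᵖ (k ·ᵖ (a , b))) ≤? t)
  ... | yes (k , _) = k
  ... | no _ = 0 mod n

  IsLatin : Array → Set
  IsLatin S =
      (∀ i s → ∃ λ j → S i j ≡ s) × (∀ i j j′ → S i j ≡ S i j′ → j ≡ j′)
    × (∀ j s → ∃ λ i → S i j ≡ s) × (∀ j i i′ → S i j ≡ S i′ j → i ≡ i′)

  Orthogonal : Array → Array → Set
  Orthogonal A B = ∀ i j i′ j′ → A i j ≡ A i′ j′ → B i j ≡ B i′ j′ → (i ≡ i′ × j ≡ j′)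

  IsPerfectSudoku : ℕ → Zn → Zn → Pt → Array → Set
  IsPerfectSudoku t a b x S = IsLatin S × Orthogonal S (palette t a b x)

  _∼_ : Array → Array → Set
  S₁ ∼ S₂ = ∃ λ (σ : Fin n ↔ Fin n) → ∀ i j → Inverse.to σ (S₁ i j) ≡ S₂ i j

  rot : Array → Array
  rot A i j = A ((n ∸ 1 ∸ toℕ j) mod n) i

  τ₁ : Array → Array
  τ₁ A i j = A (i ⊝ one) j

  τ₂ : Array → Array
  τ₂ A i j = A i (j ⊝ one)

  pow : (Array → Array) → ℕ → Array → Array
  pow f zero A = A
  pow f (suc k) A = f (pow f k A)

  gen₁ : Zn → Zn → Array → Array
  gen₁ x₁ x₂ A = pow τ₂ (toℕ ((x₁ ⊕ x₂) ⊕ one)) (pow τ₁ (toℕ (x₁ ⊝ x₂)) (rot A))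

  gen₂ : Zn → Zn → Array → Array
  gen₂ a b A = pow τ₁ (toℕ a) (pow τ₂ (toℕ b) A)

  _≗ᴬ_ : Array → Array → Set
  A ≗ᴬ B = ∀ i j → A i j ≡ B i j

  -- Reach a b x₁ x₂ S T : T = g(S) for some g in the group generated by gen₁, gen₂
  -- (words in the generators and their inverses; U is g⁻¹(T) iff g(U) = T)
  data Reach (a b x₁ x₂ : Zn) (S : Array) : Array → Set where
    here  : ∀ {T} → S ≗ᴬ T → Reach a b x₁ x₂ S T
    fwd₁  : ∀ {T U} → Reach a b x₁ x₂ S T → gen₁ x₁ x₂ T ≗ᴬ U → Reach a b x₁ x₂ S U
    fwd₂  : ∀ {T U} → Reach a b x₁ x₂ S T → gen₂ a b T ≗ᴬ U → Reach a b x₁ x₂ S U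
    inv₁  : ∀ {T U} → Reach a b x₁ x₂ S T → gen₁ x₁ x₂ U ≗ᴬ T → Reach a b x₁ x₂ S U
    inv₂  : ∀ {T U} → Reach a b x₁ x₂ S T → gen₂ a b U ≗ᴬ T → Reach a b x₁ x₂ S U

  InOrbit : Zn → Zn → Zn → Zn → Array → Array → Set
  InOrbit a b x₁ x₂ S T = ∃ λ U → Reach a b x₁ x₂ S U × (T ∼ U)

  -- L is a complete irredundant list of representatives of the orbit of [S]
  -- (so length L = size of the orbit of [S] in the set of relabeling classes)
  IsOrbitReps : Zn → Zn → Zn → Zn → Array → List Array → Set
  IsOrbitReps a b x₁ x₂ S L =
      All (InOrbit a b x₁ x₂ S) L
    × AllPairs (λ T T′ → ¬ (T ∼ T′)) L
    × (∀ T → InOrbit a b x₁ x₂ S T → Any (λ T′ → T ∼ T′) L)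

module Submission where

-- A perfect linear code is so rigid that it is invariant under a quarter turn: the codewords
-- next to the points (1, t) and (t, 1) force b ≡ c a for some c with c² ≡ -1 (mod n).  On
-- positions the first generator of G_S is a quarter turn ρ and the second a translation τ, and
-- the invariance gives τᵐ ∘ ρ = ρ ∘ τᶜᵐ, besides ρ⁴ = id and τⁿ = id.  Hence every element of G_S
-- reindexes arrays along some ρᵏ ∘ τᵐ with (k , m) ∈ Fin 4 × ℤ_n, left multiplication in G_S is
-- mirrored by bijections of this index set, and orbit–stabiliser on the index set shows that
-- every orbit of relabelling classes has size dividing 4n.

open import Level using (0ℓ)
open import Data.Nat as ℕ using (ℕ; zero; suc; NonZero; _≤_; _<_; _⊓_; s≤s)
import Data.Nat.Properties as ℕ
import Data.Nat.Tactic.RingSolver as ℕ-Solver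
open import Data.Nat.DivMod using (_mod_; _divMod_; _/_; DivMod; m<n⇒m%n≡m)
open import Data.Nat.Divisibility using (_∣_; divides; n∣m⇒m%n≡0)
open import Data.Nat.GeneralisedArithmetic using (iterate)
open import Data.Integer as ℤ using (ℤ; +_; -_; -[1+_]; ∣_∣; 0ℤ; 1ℤ)
import Data.Integer.Properties as ℤ
import Data.Integer.Divisibility.Signed as ℤ∣
open import Data.Integer.Tactic.RingSolver using (solve-∀)
open import Data.Fin as Fin using (Fin; toℕ; zero; suc)
import Data.Fin.Properties as Fin
open import Data.Fin.Patterns using (0F; 1F; 2F; 3F)
open import Data.Fin.Permutation using (↔⇒≡)
open import Data.Empty using (⊥-elim)
open import Data.Sum using (_⊎_; inj₁; inj₂)
open import Data.Sum.Function.Propositional using (_⊎-↔_)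
open import Data.Product using (Σ; ∃; ∃₂; _×_; _,_; proj₁; proj₂; uncurry; map)
open import Data.Product.Function.NonDependent.Propositional using (_×-↔_)
open import Data.List using (List; length; lookup)
open import Data.List.Membership.Propositional.Properties using (∈-lookup)
open import Data.List.Relation.Unary.All as All using (All)
open import Data.List.Relation.Unary.Any as Any using (Any)
open import Data.List.Relation.Unary.Any.Properties using (lookup-index)
open import Data.List.Relation.Unary.AllPairs using (AllPairs; _∷_)
open import Function using (_∘_; id; Inverse; _↔_; mk↔ₛ′)
open import Function.Definitions using (StrictlySurjective)
open import Function.Properties.Inverse using (↔-refl; ↔-sym; ↔-trans)
open import Relation.Binary.Bundles using (Setoid)
open import Relation.Binary.Structures using (IsEquivalence)
import Relation.Binary.Reasoning.Setoid as SetoidReasoning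
open import Relation.Binary.PropositionalEquality
open import Relation.Nullary using (¬_; Dec; yes; no)
import Relation.Nullary as Nullary
open import Relation.Unary using (Pred; Decidable; Irrelevant)
open import Axiom.UniquenessOfIdentityProofs using (module Decidable⇒UIP)
open import Defs

-- Finite counting and orbit–stabiliser

iterate-comm : ∀ {A : Set} (f : A → A) x k → f (iterate f x k) ≡ iterate f (f x) k
iterate-comm f x zero    = refl
iterate-comm f x (suc k) = iterate-comm f (f x) k

iterate-surjective : ∀ {A : Set} {f : A → A} → StrictlySurjective _≡_ f →
                     ∀ k → StrictlySurjective _≡_ (λ x → iterate f x k)
iterate-surjective f-onto zero    y = y , refl
iterate-surjective f-onto (suc k) y with iterate-surjective f-onto k y
... | z , fᵏz≡y with f-onto z
...   | x , refl = x , fᵏz≡y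

↔-iterate : ∀ {A : Set} → A ↔ A → ℕ → A ↔ A
↔-iterate e zero    = ↔-refl
↔-iterate e (suc k) = ↔-trans (↔-iterate e k) e

Dec⇒↔Fin : ∀ {P : Set} → Dec P → Nullary.Irrelevant P → ∃ λ k → P ↔ Fin k
Dec⇒↔Fin (yes p) irr = 1 , mk↔ₛ′ (λ _ → zero) (λ _ → p) (λ { zero → refl }) (irr p)
Dec⇒↔Fin (no ¬p) irr = 0 , mk↔ₛ′ (⊥-elim ∘ ¬p) (λ ()) (λ ()) (⊥-elim ∘ ¬p)

Σ-Fin-suc-↔ : ∀ {N} {P : Pred (Fin (suc N)) 0ℓ} →
              Σ (Fin (suc N)) P ↔ (P zero ⊎ Σ (Fin N) (P ∘ suc))
Σ-Fin-suc-↔ {P = P} = mk↔ₛ′ to from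
  (λ { (inj₁ _) → refl ; (inj₂ _) → refl }) (λ { (zero , _) → refl ; (suc _ , _) → refl })
  where
  to : Σ _ P → _
  to (zero  , p) = inj₁ p
  to (suc i , p) = inj₂ (i , p)
  from : _ → Σ _ P
  from (inj₁ p)       = zero , p
  from (inj₂ (i , p)) = suc i , p

Σ-Fin-↔-Fin : ∀ {N} {P : Pred (Fin N) 0ℓ} → Decidable P → Irrelevant P →
              ∃ λ s → Σ (Fin N) P ↔ Fin s
Σ-Fin-↔-Fin {zero}  P? irr = 0 , mk↔ₛ′ (λ { (() , _) }) (λ ()) (λ ()) (λ { (() , _) })
Σ-Fin-↔-Fin {suc N} P? irr with Dec⇒↔Fin (P? zero) irr | Σ-Fin-↔-Fin (P? ∘ suc) irr
... | k , P0↔ | s , ΣP∘suc↔ =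
  k ℕ.+ s , ↔-trans Σ-Fin-suc-↔ (↔-trans (P0↔ ⊎-↔ ΣP∘suc↔) (↔-sym Fin.+↔⊎))

Σ-≡ : ∀ {I : Set} {P : Pred I 0ℓ} → Irrelevant P →
      ∀ {i j} {p : P i} {q : P j} → i ≡ j → (i , p) ≡ (j , q)
Σ-≡ irr refl = cong (_ ,_) (irr _ _)

Σ-reindex-↔ : ∀ {I J : Set} {P : Pred I 0ℓ} (e : I ↔ J) → Irrelevant P →
              Σ I P ↔ Σ J (P ∘ Inverse.from e)
Σ-reindex-↔ {P = P} e irr = mk↔ₛ′
  (λ (i , p) → Inverse.to e i , subst P (sym (Inverse.strictlyInverseʳ e i)) p)
  (λ (j , p) → Inverse.from e j , p)
  (λ (j , p) → Σ-≡ irr (Inverse.strictlyInverseˡ e j))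
  (λ (i , p) → Σ-≡ irr (Inverse.strictlyInverseʳ e i))

Σ-↔-Fin : ∀ {I : Set} {N} {P : Pred I 0ℓ} → I ↔ Fin N → Decidable P → Irrelevant P →
          ∃ λ s → Σ I P ↔ Fin s
Σ-↔-Fin e P? irr with Σ-Fin-↔-Fin (P? ∘ Inverse.from e) irr
... | s , ΣP↔ = s , ↔-trans (Σ-reindex-↔ e irr) ΣP↔

lookup-injective : ∀ {a ℓ} {A : Set a} {_≈_ : A → A → Set ℓ} {xs : List A} → (∀ {x y} → x ≈ y → y ≈ x) →
                   AllPairs (λ x y → ¬ x ≈ y) xs → ∀ {i j} → lookup xs i ≈ lookup xs j → i ≡ j
lookup-injective ≈-sym (_  ∷ _)  {zero}  {zero}  _  = refl
lookup-injective ≈-sym (x≉ ∷ _)  {zero}  {suc j} x≈ = ⊥-elim (All.lookup x≉ (∈-lookup j) x≈)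
lookup-injective ≈-sym (x≉ ∷ _)  {suc i} {zero}  ≈x = ⊥-elim (All.lookup x≉ (∈-lookup i) (≈-sym ≈x))
lookup-injective ≈-sym (_  ∷ ps) {suc i} {suc j} eq = cong suc (lookup-injective ≈-sym ps eq)

module OrbitCounting {a ℓ} (X : Setoid a ℓ) {I : Set} {N : ℕ} (I↔Fin : I ↔ Fin N)
  (act : I → Setoid.Carrier X → Setoid.Carrier X) where
  open Setoid X renaming (Carrier to Point; refl to ≈-refl; sym to ≈-sym; trans to ≈-trans)

  module _ (act-cong : ∀ h {x y} → x ≈ y → act h x ≈ act h y)
           (act-injective : ∀ h {x y} → act h x ≈ act h y → x ≈ y)
           (x : Point) (e : I) (act-e : act e x ≈ x)
           (left-mul : I → I ↔ I)
           (act-left-mul : ∀ h h′ → act (Inverse.to (left-mul h) h′) x ≈ act h (act h′ x))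
           (L : List Point)
           (L⊆orbit : All (λ y → ∃ λ h → y ≈ act h x) L)
           (L-distinct : AllPairs (λ y z → ¬ y ≈ z) L)
           (orbit⊆L : ∀ h → Any (act h x ≈_) L) where

    open Decidable⇒UIP (Fin._≟_ {length L}) using (≡-irrelevant)

    class : I → Fin (length L)
    class h = Any.index (orbit⊆L h)

    class-spec : ∀ h → act h x ≈ lookup L (class h)
    class-spec h = lookup-index (orbit⊆L h)

    class-≡⇒≈ : ∀ {h h′} → class h ≡ class h′ → act h x ≈ act h′ x
    class-≡⇒≈ {h} {h′} eq =
      ≈-trans (class-spec h) (subst (λ i → lookup L i ≈ act h′ x) (sym eq) (≈-sym (class-spec h′)))

    ≈⇒class-≡ : ∀ {h h′} → act h x ≈ act h′ x → class h ≡ class h′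
    ≈⇒class-≡ {h} {h′} hx≈h′x =
      lookup-injective ≈-sym L-distinct (≈-trans (≈-sym (class-spec h)) (≈-trans hx≈h′x (class-spec h′)))

    rep : Fin (length L) → I
    rep i = proj₁ (All.lookup L⊆orbit (∈-lookup i))

    class-rep : ∀ i → class (rep i) ≡ i
    class-rep i = lookup-injective ≈-sym L-distinct
      (≈-sym (≈-trans (proj₂ (All.lookup L⊆orbit (∈-lookup i))) (class-spec (rep i))))

    Stabiliser : Set
    Stabiliser = Σ I λ h → class h ≡ class e

    class-left-mul : ∀ h {s} → class s ≡ class e → class (Inverse.to (left-mul h) s) ≡ class h
    class-left-mul h {s} s∈stab =
      ≈⇒class-≡ (≈-trans (act-left-mul h s) (act-cong h (≈-trans (class-≡⇒≈ s∈stab) act-e)))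

    class-from-left-mul : ∀ h {h′} → class h′ ≡ class h → class (Inverse.from (left-mul h) h′) ≡ class e
    class-from-left-mul h {h′} eq = ≈⇒class-≡ (act-injective h (begin
      act h (act h″ x)                     ≈⟨ act-left-mul h h″ ⟨
      act (Inverse.to (left-mul h) h″) x   ≡⟨ cong (λ g → act g x) (Inverse.strictlyInverseˡ (left-mul h) h′) ⟩
      act h′ x                             ≈⟨ class-≡⇒≈ eq ⟩
      act h x                              ≈⟨ act-cong h act-e ⟨
      act h (act e x)                      ∎))
      where
      open SetoidReasoning X
      h″ = Inverse.from (left-mul h) h′

    -- Left multiplication by the representative of a class maps the stabiliser onto that class.
    split : I ↔ (Fin (length L) × Stabiliser)
    split = mk↔ₛ′ to from to∘from (λ h → Inverse.strictlyInverseˡ (left-mul (rep (class h))) h)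
      where
      to : I → Fin (length L) × Stabiliser
      to h = class h , Inverse.from (left-mul (rep (class h))) h
                     , class-from-left-mul (rep (class h)) (sym (class-rep (class h)))
      from : Fin (length L) × Stabiliser → I
      from (i , s , _) = Inverse.to (left-mul (rep i)) s
      to∘from : ∀ y → to (from y) ≡ y
      to∘from (i , s , s∈stab) = cong₂ _,_ class≡i (Σ-≡ (λ _ _ → ≡-irrelevant _ _) (begin
        Inverse.from (left-mul (rep (class (from (i , s , s∈stab))))) (from (i , s , s∈stab))
          ≡⟨ cong (λ j → Inverse.from (left-mul (rep j)) (from (i , s , s∈stab))) class≡i ⟩
        Inverse.from (left-mul (rep i)) (Inverse.to (left-mul (rep i)) s)
          ≡⟨ Inverse.strictlyInverseʳ (left-mul (rep i)) s ⟩
        s ∎))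
        where
        open ≡-Reasoning
        class≡i : class (Inverse.to (left-mul (rep i)) s) ≡ i
        class≡i = trans (class-left-mul (rep i) s∈stab) (class-rep i)

    orbit-length-∣ : length L ∣ N
    orbit-length-∣ with Σ-↔-Fin I↔Fin (λ h → class h Fin.≟ class e) (λ _ _ → ≡-irrelevant _ _)
    ... | s , Stabiliser↔Fin = divides s (trans (↔⇒≡ Fin-N↔Fin-ℓs) (ℕ.*-comm (length L) s))
      where
      Fin-N↔Fin-ℓs : Fin N ↔ Fin (length L ℕ.* s)
      Fin-N↔Fin-ℓs =
        ↔-trans (↔-sym I↔Fin) (↔-trans split (↔-trans (↔-refl ×-↔ Stabiliser↔Fin) (↔-sym Fin.*↔×)))

module _ where
  open import Data.Nat using (_+_; _*_)

  squeeze : ∀ t {p₁ p₂ w₁ w₂ e₁ e₂} → p₁ + p₂ ≡ suc t → w₁ + w₂ ≤ t →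
            e₁ ≤ p₁ + w₁ → e₂ ≤ p₂ + w₂ → 2 * t + 1 ≤ e₁ + e₂ →
            e₁ ≡ p₁ + w₁ × e₂ ≡ p₂ + w₂ × w₁ + w₂ ≡ t × (p₁ + w₁) + (p₂ + w₂) ≡ 2 * t + 1
  squeeze t {p₁} {p₂} {w₁} {w₂} {e₁} {e₂} p₁+p₂≡1+t w₁+w₂≤t e₁≤ e₂≤ 2t+1≤e₁+e₂ =
    tight e₁≤ e₂≤ 2t+1≤e₁+e₂ sum≡2t+1 ,
    tight e₂≤ e₁≤ (subst (2 * t + 1 ≤_) (ℕ.+-comm e₁ e₂) 2t+1≤e₁+e₂)
                  (trans (ℕ.+-comm (p₂ + w₂) _) sum≡2t+1) ,
    w₁+w₂≡t ,
    sum≡2t+1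
    where
    open ℕ.≤-Reasoning
    sum≡ : (p₁ + w₁) + (p₂ + w₂) ≡ suc t + (w₁ + w₂)
    sum≡ = trans (regroup p₁ w₁ p₂ w₂) (cong (_+ (w₁ + w₂)) p₁+p₂≡1+t)
      where
      regroup : ∀ p₁ w₁ p₂ w₂ → (p₁ + w₁) + (p₂ + w₂) ≡ (p₁ + p₂) + (w₁ + w₂)
      regroup = ℕ-Solver.solve-∀
    1+t+t≡2t+1 : suc t + t ≡ 2 * t + 1
    1+t+t≡2t+1 = identity t
      where
      identity : ∀ t → suc t + t ≡ 2 * t + 1
      identity = ℕ-Solver.solve-∀
    w₁+w₂≡t : w₁ + w₂ ≡ t
    w₁+w₂≡t = ℕ.≤-antisym w₁+w₂≤t (ℕ.+-cancelˡ-≤ (suc t) t (w₁ + w₂) (begin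
      suc t + t               ≡⟨ 1+t+t≡2t+1 ⟩
      2 * t + 1               ≤⟨ 2t+1≤e₁+e₂ ⟩
      e₁ + e₂                 ≤⟨ ℕ.+-mono-≤ e₁≤ e₂≤ ⟩
      (p₁ + w₁) + (p₂ + w₂)   ≡⟨ sum≡ ⟩
      suc t + (w₁ + w₂)       ∎))
    sum≡2t+1 : (p₁ + w₁) + (p₂ + w₂) ≡ 2 * t + 1
    sum≡2t+1 = trans sum≡ (trans (cong (_+_ (suc t)) w₁+w₂≡t) 1+t+t≡2t+1)
    tight : ∀ {a₁ a₂ b₁ b₂} → a₁ ≤ b₁ → a₂ ≤ b₂ →
            2 * t + 1 ≤ a₁ + a₂ → b₁ + b₂ ≡ 2 * t + 1 → a₁ ≡ b₁
    tight {a₁} {a₂} {b₁} {b₂} a₁≤b₁ a₂≤b₂ 2t+1≤a₁+a₂ b₁+b₂≡2t+1 =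
      ℕ.≤-antisym a₁≤b₁ (ℕ.+-cancelʳ-≤ a₂ b₁ a₁ (begin
        b₁ + a₂     ≤⟨ ℕ.+-monoʳ-≤ b₁ a₂≤b₂ ⟩
        b₁ + b₂     ≡⟨ b₁+b₂≡2t+1 ⟩
        2 * t + 1   ≤⟨ 2t+1≤a₁+a₂ ⟩
        a₁ + a₂     ∎))

module _ where
  open import Data.Integer using (_+_; _-_; _*_)

  pos-∸ : ∀ {k m} → m ≤ k → + (k ℕ.∸ m) ≡ + k - + m
  pos-∸ {k} {m} m≤k = trans (sym (ℤ.≤-⊖ m≤k)) (sym (ℤ.m-n≡m⊖n k m))

  ∣p-z∣≡p+∣z∣⇒p-z≡p+∣z∣ : ∀ {p} z → 1 ≤ p → ∣ + p - z ∣ ≡ p ℕ.+ ∣ z ∣ →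
                          + p - z ≡ + (p ℕ.+ ∣ z ∣)
  ∣p-z∣≡p+∣z∣⇒p-z≡p+∣z∣ (+ zero)  _   _ = refl
  ∣p-z∣≡p+∣z∣⇒p-z≡p+∣z∣ -[1+ w ]  _   _ = refl
  ∣p-z∣≡p+∣z∣⇒p-z≡p+∣z∣ {p} (+ suc w) 1≤p eq = ⊥-elim (ℕ.<-irrefl refl (begin-strict
    p ℕ.+ suc w       ≡⟨ eq ⟨
    ∣ + p - + suc w ∣ ≡⟨ cong ∣_∣ (ℤ.m-n≡m⊖n p (suc w)) ⟩
    ∣ p ℤ.⊖ suc w ∣   ≤⟨ ℤ.∣m⊝n∣≤m⊔n p (suc w) ⟩
    p ℕ.⊔ suc w       ≤⟨ ℕ.⊔-lub (ℕ.m≤m+n p w) (ℕ.+-monoˡ-≤ w 1≤p) ⟩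
    p ℕ.+ w           <⟨ ℕ.+-monoʳ-< p (ℕ.n<1+n w) ⟩
    p ℕ.+ suc w       ∎))
    where open ℕ.≤-Reasoning

-- Congruence modulo n

module Congruence (n : ℕ) .{{_ : NonZero n}} where
  open import Data.Integer using (_+_; _-_; _*_)
  open ℤ∣ using (divides; ∣⇒∣ᵤ; ∣m∣n⇒∣m+n; ∣m⇒∣-m; ∣n⇒∣m*n) renaming (_∣_ to _∣ℤ_)

  infix 4 _≈_
  record _≈_ (x y : ℤ) : Set where
    constructor mod-n
    field
      n∣x-y : + n ∣ℤ x - y

  ≈-via : ∀ {x y e} → e ≡ x - y → + n ∣ℤ e → x ≈ y
  ≈-via refl = mod-n

  ≈-by-scaling : ∀ {x y u v} k → x - y ≡ k * (u - v) → u ≈ v → x ≈ y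
  ≈-by-scaling k eq (mod-n n∣u-v) = ≈-via (sym eq) (∣n⇒∣m*n k n∣u-v)

  ≈-by-lincomb : ∀ {x y u v} k l → x - y ≡ k * (u - v) + l * + n → u ≈ v → x ≈ y
  ≈-by-lincomb k l eq (mod-n n∣u-v) =
    ≈-via (sym eq) (∣m∣n⇒∣m+n (∣n⇒∣m*n k n∣u-v) (∣n⇒∣m*n l (divides 1ℤ (sym (ℤ.*-identityˡ (+ n))))))

  ≈-reflexive : ∀ {x y} → x ≡ y → x ≈ y
  ≈-reflexive {x} refl = mod-n (divides 0ℤ (ℤ.+-inverseʳ x))

  ≈-refl : ∀ {x} → x ≈ x
  ≈-refl = ≈-reflexive refl

  ≈-sym : ∀ {x y} → x ≈ y → y ≈ x
  ≈-sym {x} {y} (mod-n p) = ≈-via (swap x y) (∣m⇒∣-m p)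
    where
    swap : ∀ x y → - (x - y) ≡ y - x
    swap = solve-∀

  ≈-trans : ∀ {x y z} → x ≈ y → y ≈ z → x ≈ z
  ≈-trans {x} {y} {z} (mod-n p) (mod-n q) = ≈-via (telescope x y z) (∣m∣n⇒∣m+n p q)
    where
    telescope : ∀ x y z → (x - y) + (y - z) ≡ x - z
    telescope = solve-∀

  ≈-isEquivalence : IsEquivalence _≈_
  ≈-isEquivalence = record { refl = ≈-refl ; sym = ≈-sym ; trans = ≈-trans }

  ≈-setoid : Setoid 0ℓ 0ℓ
  ≈-setoid = record { isEquivalence = ≈-isEquivalence }

  module ≈-Reasoning = SetoidReasoning ≈-setoid

  +-cong : ∀ {x y u v} → x ≈ y → u ≈ v → x + u ≈ y + v
  +-cong {x} {y} {u} {v} (mod-n p) (mod-n q) = ≈-via (regroup x y u v) (∣m∣n⇒∣m+n p q)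
    where
    regroup : ∀ x y u v → (x - y) + (u - v) ≡ (x + u) - (y + v)
    regroup = solve-∀

  *-cong : ∀ {x y u v} → x ≈ y → u ≈ v → x * u ≈ y * v
  *-cong {x} {y} {u} {v} (mod-n p) (mod-n q) =
    ≈-via (regroup x y u v) (∣m∣n⇒∣m+n (∣n⇒∣m*n u p) (∣n⇒∣m*n y q))
    where
    regroup : ∀ x y u v → u * (x - y) + y * (u - v) ≡ x * u - y * v
    regroup = solve-∀

  -‿cong : ∀ {x y} → x ≈ y → - x ≈ - y
  -‿cong {x} {y} = ≈-by-scaling (- 1ℤ) (regroup x y)
    where
    regroup : ∀ x y → - x - - y ≡ - 1ℤ * (x - y)
    regroup = solve-∀

  n≈0 : + n ≈ 0ℤ
  n≈0 = mod-n (divides 1ℤ (trans (ℤ.+-identityʳ (+ n)) (sym (ℤ.*-identityˡ (+ n)))))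

  ι : Zn n → ℤ
  ι u = + toℕ u

  ι-mod : ∀ m → ι (m mod n) ≈ + m
  ι-mod m = ≈-sym (mod-n (divides (+ q) (begin
      + m - + r               ≡⟨ cong (λ k → + k - + r) (DivMod.property (m divMod n)) ⟩
      + (r ℕ.+ q ℕ.* n) - + r ≡⟨ cong (_- + r) (ℤ.pos-+ r (q ℕ.* n)) ⟩
      + r + + (q ℕ.* n) - + r ≡⟨ cancel (+ r) (+ (q ℕ.* n)) ⟩
      + (q ℕ.* n)             ≡⟨ ℤ.pos-* q n ⟩
      + q * + n               ∎)))
    where
    open ≡-Reasoning
    r = toℕ (m mod n)
    q = m / n
    cancel : ∀ r s → r + s - r ≡ s
    cancel = solve-∀

  ι-⊕ : ∀ u v → ι (_⊕_ n u v) ≈ ι u + ι v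
  ι-⊕ u v = ≈-trans (ι-mod (toℕ u ℕ.+ toℕ v)) (≈-reflexive (ℤ.pos-+ (toℕ u) (toℕ v)))

  ι-⊛ : ∀ u v → ι (_⊛_ n u v) ≈ ι u * ι v
  ι-⊛ u v = ≈-trans (ι-mod (toℕ u ℕ.* toℕ v)) (≈-reflexive (ℤ.pos-* (toℕ u) (toℕ v)))

  ι-⊖ : ∀ u → ι (⊖_ n u) ≈ - ι u
  ι-⊖ u = begin
    ι (⊖_ n u)        ≈⟨ ι-mod (n ℕ.∸ toℕ u) ⟩
    + (n ℕ.∸ toℕ u)   ≡⟨ pos-∸ (ℕ.<⇒≤ (Fin.toℕ<n u)) ⟩
    + n - ι u         ≈⟨ +-cong n≈0 (≈-refl { - ι u}) ⟩
    0ℤ - ι u          ≡⟨ ℤ.+-identityˡ (- ι u) ⟩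
    - ι u             ∎
    where open ≈-Reasoning

  ι-⊝ : ∀ u v → ι (_⊝_ n u v) ≈ ι u - ι v
  ι-⊝ u v = ≈-trans (ι-⊕ u (⊖_ n v)) (+-cong (≈-refl {ι u}) (ι-⊖ v))

  ι-one : ι (one n) ≈ 1ℤ
  ι-one = ι-mod 1

  ι-⊕-one : ∀ u → ι (_⊕_ n u (one n)) ≈ ι u + 1ℤ
  ι-⊕-one u = ≈-trans (ι-⊕ u (one n)) (+-cong (≈-refl {ι u}) ι-one)

  ι-⊝-one : ∀ u → ι (_⊝_ n u (one n)) ≈ ι u - 1ℤ
  ι-⊝-one u = ≈-trans (ι-⊝ u (one n)) (+-cong (≈-refl {ι u}) (-‿cong ι-one))

  +-≈-injective : ∀ {a b} → a < n → b < n → + a ≈ + b → a ≡ b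
  +-≈-injective {a} {b} a<n b<n (mod-n n∣a-b) =
    ℤ.+-injective (ℤ.i-j≡0⇒i≡j (+ a) (+ b) (ℤ.∣i∣≡0⇒i≡0 ∣a-b∣≡0))
    where
    ∣a-b∣<n : ∣ + a - + b ∣ < n
    ∣a-b∣<n = ℕ.≤-<-trans (ℕ.≤-reflexive (cong ∣_∣ (ℤ.m-n≡m⊖n a b)))
                (ℕ.≤-<-trans (ℤ.∣m⊝n∣≤m⊔n a b) (ℕ.⊔-lub a<n b<n))
    ∣a-b∣≡0 : ∣ + a - + b ∣ ≡ 0
    ∣a-b∣≡0 = trans (sym (m<n⇒m%n≡m ∣a-b∣<n)) (n∣m⇒m%n≡0 _ n (∣⇒∣ᵤ n∣a-b))

  ι-injective : ∀ {u v} → ι u ≈ ι v → u ≡ v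
  ι-injective {u} {v} = Fin.toℕ-injective ∘ +-≈-injective (Fin.toℕ<n u) (Fin.toℕ<n v)

-- Lee weight

module LeeWeight (n : ℕ) .{{_ : NonZero n}} where
  open import Data.Integer using (_+_; _-_; _*_)
  open ℤ∣ using (divides)
  open Congruence n

  n-u : ∀ u → + (n ℕ.∸ toℕ u) ≡ + n - ι u
  n-u u = pos-∸ (ℕ.<⇒≤ (Fin.toℕ<n u))

  wtL₁-≤-∣∣ : ∀ u {z} → ι u ≈ z → wtL₁ n u ≤ ∣ z ∣
  wtL₁-≤-∣∣ u {z} (mod-n (divides q u-z≡qn)) =
    bound q (trans (sym (cancel (ι u) z)) (cong (_-_ (ι u)) u-z≡qn))
    where
    cancel : ∀ u z → u - (u - z) ≡ z
    cancel = solve-∀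
    open ≡-Reasoning
    bound : ∀ q → z ≡ ι u - q * + n → wtL₁ n u ≤ ∣ z ∣
    bound (+ zero) z≡u =
      ℕ.≤-trans (ℕ.m⊓n≤m (toℕ u) _) (ℕ.≤-reflexive (cong ∣_∣ (sym (trans z≡u (ℤ.+-identityʳ (ι u))))))
    bound (+ suc j) z≡u-qn =
      ℕ.≤-trans (ℕ.m⊓n≤n (toℕ u) _) (ℕ.≤-trans (ℕ.m≤m+n _ (j ℕ.* n)) (ℕ.≤-reflexive (sym (begin
      ∣ z ∣                              ≡⟨ ℤ.∣-i∣≡∣i∣ z ⟨
      ∣ - z ∣                            ≡⟨ cong (∣_∣ ∘ -_) z≡u-qn ⟩
      ∣ - (ι u - (1ℤ + + j) * + n) ∣     ≡⟨ cong ∣_∣ (regroup (ι u) (+ j) (+ n)) ⟩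
      ∣ (+ n - ι u) + + j * + n ∣        ≡⟨ cong ∣_∣ (cong₂ _+_ (n-u u) (ℤ.pos-* j n)) ⟨
      ∣ + (n ℕ.∸ toℕ u) + + (j ℕ.* n) ∣  ≡⟨ cong ∣_∣ (ℤ.pos-+ (n ℕ.∸ toℕ u) (j ℕ.* n)) ⟨
      n ℕ.∸ toℕ u ℕ.+ j ℕ.* n           ∎))))
      where
      regroup : ∀ u j n → - (u - (1ℤ + j) * n) ≡ (n - u) + j * n
      regroup = solve-∀
    bound -[1+ j ] z≡u-qn =
      ℕ.≤-trans (ℕ.m⊓n≤m (toℕ u) _) (ℕ.≤-trans (ℕ.m≤m+n _ (suc j ℕ.* n)) (ℕ.≤-reflexive (sym (begin
      ∣ z ∣                              ≡⟨ cong ∣_∣ z≡u-qn ⟩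
      ∣ ι u - - (+ suc j) * + n ∣        ≡⟨ cong ∣_∣ (regroup (ι u) (+ suc j) (+ n)) ⟩
      ∣ ι u + + suc j * + n ∣            ≡⟨ cong (λ k → ∣ ι u + k ∣) (ℤ.pos-* (suc j) n) ⟨
      ∣ ι u + + (suc j ℕ.* n) ∣          ≡⟨ cong ∣_∣ (ℤ.pos-+ (toℕ u) (suc j ℕ.* n)) ⟨
      toℕ u ℕ.+ suc j ℕ.* n             ∎))))
      where
      regroup : ∀ u s n → u - - s * n ≡ u + s * n
      regroup = solve-∀

  wtL₁-attained : ∀ u → ∃ λ z → ι u ≈ z × ∣ z ∣ ≡ wtL₁ n u
  wtL₁-attained u with toℕ u ℕ.≤? n ℕ.∸ toℕ u
  ... | yes u≤n-u = ι u , ≈-refl , sym (ℕ.m≤n⇒m⊓n≡m u≤n-u)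
  ... | no  u≰n-u = - + (n ℕ.∸ toℕ u)
                  , mod-n (divides 1ℤ (trans (cong (λ k → ι u - - k) (n-u u)) (sym (regroup (ι u) (+ n)))))
                  , trans (ℤ.∣-i∣≡∣i∣ (+ (n ℕ.∸ toℕ u))) (sym (ℕ.m≥n⇒m⊓n≡n (ℕ.≰⇒≥ u≰n-u)))
    where
    regroup : ∀ u n → 1ℤ * n ≡ u - - (n - u)
    regroup = solve-∀

  wtL₁-small : ∀ u {p} → ι u ≈ + p → p ℕ.+ p < n → wtL₁ n u ≡ p
  wtL₁-small u {p} u≈p 2p<n = trans (cong (λ m → m ⊓ (n ℕ.∸ m)) u≡p) (ℕ.m≤n⇒m⊓n≡m p≤n-p)
    where
    u≡p : toℕ u ≡ p
    u≡p = +-≈-injective (Fin.toℕ<n u) (ℕ.≤-<-trans (ℕ.m≤m+n p p) 2p<n) u≈p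
    p≤n-p : p ≤ n ℕ.∸ p
    p≤n-p = subst (_≤ n ℕ.∸ p) (ℕ.m+n∸n≡m p p) (ℕ.∸-monoˡ-≤ p (ℕ.<⇒≤ 2p<n))

  ι-⊝-zero : ∀ u → ι (_⊝_ n u (0 mod n)) ≈ ι u
  ι-⊝-zero u = begin
    ι (_⊝_ n u (0 mod n))   ≈⟨ ι-⊝ u (0 mod n) ⟩
    ι u - ι (0 mod n)       ≈⟨ +-cong (≈-refl {ι u}) (-‿cong (ι-mod 0)) ⟩
    ι u - 0ℤ                ≡⟨ ℤ.+-identityʳ (ι u) ⟩
    ι u                     ∎
    where open ≈-Reasoning

  difference-representative : ∀ {p} P c → ι P ≈ + p → ∃ λ z → ∣ z ∣ ≡ wtL₁ n (_⊝_ n P c) × ι c ≈ + p - z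
  difference-representative {p} P c P≈p with wtL₁-attained (_⊝_ n P c)
  ... | z , P-c≈z , ∣z∣≡wt = z , ∣z∣≡wt , ≈-trans (≈-reflexive (sym (cancel (ι P) (ι c))))
                                            (+-cong P≈p (-‿cong (≈-trans (≈-sym (ι-⊝ P c)) P-c≈z)))
    where
    cancel : ∀ P c → P - (P - c) ≡ c
    cancel = solve-∀

  near-and-far⇒beyond′ : ∀ t {p₁ p₂} → 1 ≤ p₁ → 1 ≤ p₂ → p₁ ℕ.+ p₂ ≡ suc t → 2 ℕ.* t ℕ.+ 1 < n →
    ∀ c₁ c₂ z₁ z₂ → ι c₁ ≈ + p₁ - z₁ → ι c₂ ≈ + p₂ - z₂ →
    ∣ z₁ ∣ ℕ.+ ∣ z₂ ∣ ≤ t → 2 ℕ.* t ℕ.+ 1 ≤ ∣ + p₁ - z₁ ∣ ℕ.+ ∣ + p₂ - z₂ ∣ →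
    ∃₂ λ w₁ w₂ → toℕ c₁ ≡ p₁ ℕ.+ w₁ × toℕ c₂ ≡ p₂ ℕ.+ w₂ × w₁ ℕ.+ w₂ ≡ t
  near-and-far⇒beyond′ t {p₁} {p₂} 1≤p₁ 1≤p₂ p₁+p₂≡1+t 2t+1<n c₁ c₂ z₁ z₂ c₁≈p₁-z₁ c₂≈p₂-z₂ near far
    with squeeze t {p₁} {p₂} {∣ z₁ ∣} {∣ z₂ ∣} {∣ + p₁ - z₁ ∣} {∣ + p₂ - z₂ ∣} p₁+p₂≡1+t near
                 (ℤ.∣i-j∣≤∣i∣+∣j∣ (+ p₁) z₁) (ℤ.∣i-j∣≤∣i∣+∣j∣ (+ p₂) z₂) far
  ... | e₁≡ , e₂≡ , w₁+w₂≡t , sum≡2t+1 = ∣ z₁ ∣ , ∣ z₂ ∣ , c₁≡ , c₂≡ , w₁+w₂≡t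
    where
    sum<n : (p₁ ℕ.+ ∣ z₁ ∣) ℕ.+ (p₂ ℕ.+ ∣ z₂ ∣) < n
    sum<n = subst (_< n) (sym sum≡2t+1) 2t+1<n
    c₁≡ : toℕ c₁ ≡ p₁ ℕ.+ ∣ z₁ ∣
    c₁≡ = +-≈-injective (Fin.toℕ<n c₁) (ℕ.≤-<-trans (ℕ.m≤m+n (p₁ ℕ.+ ∣ z₁ ∣) _) sum<n)
            (≈-trans c₁≈p₁-z₁ (≈-reflexive (∣p-z∣≡p+∣z∣⇒p-z≡p+∣z∣ z₁ 1≤p₁ e₁≡)))
    c₂≡ : toℕ c₂ ≡ p₂ ℕ.+ ∣ z₂ ∣
    c₂≡ = +-≈-injective (Fin.toℕ<n c₂) (ℕ.≤-<-trans (ℕ.m≤n+m (p₂ ℕ.+ ∣ z₂ ∣) (p₁ ℕ.+ ∣ z₁ ∣)) sum<n)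
            (≈-trans c₂≈p₂-z₂ (≈-reflexive (∣p-z∣≡p+∣z∣⇒p-z≡p+∣z∣ z₂ 1≤p₂ e₂≡)))

  -- The triangle inequality through p = (p₁ , p₂) must be tight, so c lies coordinatewise beyond p.
  near-and-far⇒beyond : ∀ t {p₁ p₂} → 1 ≤ p₁ → 1 ≤ p₂ → p₁ ℕ.+ p₂ ≡ suc t → 2 ℕ.* t ℕ.+ 1 < n →
    ∀ c₁ c₂ → dL n (p₁ mod n , p₂ mod n) (c₁ , c₂) ≤ t → 2 ℕ.* t ℕ.+ 1 ≤ dL n (c₁ , c₂) (0 mod n , 0 mod n) →
    ∃₂ λ w₁ w₂ → toℕ c₁ ≡ p₁ ℕ.+ w₁ × toℕ c₂ ≡ p₂ ℕ.+ w₂ × w₁ ℕ.+ w₂ ≡ t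
  near-and-far⇒beyond t {p₁} {p₂} 1≤p₁ 1≤p₂ p₁+p₂≡1+t 2t+1<n c₁ c₂ near far =
    near-and-far⇒beyond′ t 1≤p₁ 1≤p₂ p₁+p₂≡1+t 2t+1<n c₁ c₂ z₁ z₂ c₁≈p₁-z₁ c₂≈p₂-z₂
      (subst₂ (λ x y → x ℕ.+ y ≤ t) (sym ∣z₁∣≡wt) (sym ∣z₂∣≡wt) near)
      (ℕ.≤-trans far (ℕ.+-mono-≤ (wtL₁-≤-∣∣ _ (≈-trans (ι-⊝-zero c₁) c₁≈p₁-z₁))
                                 (wtL₁-≤-∣∣ _ (≈-trans (ι-⊝-zero c₂) c₂≈p₂-z₂))))
    where
    r₁ = difference-representative (p₁ mod n) c₁ (ι-mod p₁)
    r₂ = difference-representative (p₂ mod n) c₂ (ι-mod p₂)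
    z₁ = proj₁ r₁
    z₂ = proj₁ r₂
    ∣z₁∣≡wt = proj₁ (proj₂ r₁)
    ∣z₂∣≡wt = proj₁ (proj₂ r₂)
    c₁≈p₁-z₁ = proj₂ (proj₂ r₁)
    c₂≈p₂-z₂ = proj₂ (proj₂ r₂)

-- Linear perfect codes are invariant under a quarter turn

module _ (n : ℕ) .{{_ : NonZero n}} where
  open import Data.Integer using (_+_; _*_)
  open Congruence n

  -- Multiplication by c sends the generator (a , b) to its quarter turn (b , -a).
  record RotationMultiplier (a b : Zn n) : Set where
    field
      c      : ℕ
      b≈ca   : ι b ≈ + c * ι a
      c²+1≈0 : + c * + c + 1ℤ ≈ 0ℤ

module Classification (t : ℕ) (1≤t : 1 ≤ t) where
  open import Data.Integer using (_+_; _-_; _*_)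

  n : ℕ
  n = 1 ℕ.+ 2 ℕ.* t ℕ.* t ℕ.+ 2 ℕ.* t

  open Congruence n
  open LeeWeight n

  T N : ℤ
  T = + t
  N = 1ℤ + + 2 * T * T + + 2 * T

  +n≡N : + n ≡ N
  +n≡N = begin
    + (1 ℕ.+ 2 ℕ.* t ℕ.* t ℕ.+ 2 ℕ.* t)   ≡⟨ ℤ.pos-+ (1 ℕ.+ 2 ℕ.* t ℕ.* t) (2 ℕ.* t) ⟩
    + (1 ℕ.+ 2 ℕ.* t ℕ.* t) + + (2 ℕ.* t) ≡⟨ cong₂ _+_ (ℤ.pos-+ 1 (2 ℕ.* t ℕ.* t)) (ℤ.pos-* 2 t) ⟩
    1ℤ + + (2 ℕ.* t ℕ.* t) + + 2 * T      ≡⟨ cong (λ x → 1ℤ + x + + 2 * T) 2t²≡ ⟩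
    N                                     ∎
    where
    open ≡-Reasoning
    2t²≡ : + (2 ℕ.* t ℕ.* t) ≡ + 2 * T * T
    2t²≡ = trans (ℤ.pos-* (2 ℕ.* t) t) (cong (_* T) (ℤ.pos-* 2 t))

  ≈-by-lincomb-N : ∀ {x y u v} k l → x - y ≡ k * (u - v) + l * N → u ≈ v → x ≈ y
  ≈-by-lincomb-N {u = u} {v} k l eq = ≈-by-lincomb k l (trans eq (cong (λ M → k * (u - v) + l * M) (sym +n≡N)))

  ≈-by-multiple-N : ∀ {x y} l → x - y ≡ l * N → x ≈ y
  ≈-by-multiple-N l eq = ≈-by-lincomb-N 0ℤ l (trans eq (sym (ℤ.+-identityˡ _))) (≈-refl {0ℤ})

  2t+1<n : 2 ℕ.* t ℕ.+ 1 < n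
  2t+1<n = subst (2 ℕ.* t ℕ.+ 1 <_) (regroup t) (ℕ.m<m+n (2 ℕ.* t ℕ.+ 1) 0<2t²)
    where
    0<2t² : 0 < 2 ℕ.* t ℕ.* t
    0<2t² = ℕ.*-mono-≤ (ℕ.≤-trans 1≤t (ℕ.m≤n*m t 2)) 1≤t
    regroup : ∀ t → 2 ℕ.* t ℕ.+ 1 ℕ.+ 2 ℕ.* t ℕ.* t ≡ 1 ℕ.+ 2 ℕ.* t ℕ.* t ℕ.+ 2 ℕ.* t
    regroup = ℕ-Solver.solve-∀

  module _ (a b : Zn n) where

    cross : ∀ k k′ → ι (_⊛_ n k a) * ι (_⊛_ n k′ b) ≈ ι (_⊛_ n k b) * ι (_⊛_ n k′ a)
    cross k k′ = begin
      ι (_⊛_ n k a) * ι (_⊛_ n k′ b)   ≈⟨ *-cong (ι-⊛ k a) (ι-⊛ k′ b) ⟩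
      (ι k * ι a) * (ι k′ * ι b)       ≡⟨ swap (ι k) (ι k′) (ι a) (ι b) ⟩
      (ι k * ι b) * (ι k′ * ι a)       ≈⟨ *-cong (ι-⊛ k b) (ι-⊛ k′ a) ⟨
      ι (_⊛_ n k b) * ι (_⊛_ n k′ a)   ∎
      where
      open ≈-Reasoning
      swap : ∀ k k′ a b → (k * a) * (k′ * b) ≡ (k * b) * (k′ * a)
      swap = solve-∀

    proportional : ∀ k → ι a * ι (_⊛_ n k b) ≈ ι b * ι (_⊛_ n k a)
    proportional k = begin
      ι a * ι (_⊛_ n k b)               ≈⟨ *-cong (ι-one⊛ a) ≈-refl ⟨
      ι (_⊛_ n (one n) a) * ι (_⊛_ n k b) ≈⟨ cross (one n) k ⟩
      ι (_⊛_ n (one n) b) * ι (_⊛_ n k a) ≈⟨ *-cong (ι-one⊛ b) ≈-refl ⟩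
      ι b * ι (_⊛_ n k a)               ∎
      where
      open ≈-Reasoning
      ι-one⊛ : ∀ u → ι (_⊛_ n (one n) u) ≈ ι u
      ι-one⊛ u = ≈-trans (ι-⊛ (one n) u) (≈-trans (*-cong ι-one (≈-refl {ι u})) (≈-reflexive (ℤ.*-identityˡ (ι u))))

    CodewordBeyond : ℕ → ℕ → Set
    CodewordBeyond p₁ p₂ = ∃ λ k → ∃₂ λ w₁ w₂ →
      toℕ (_⊛_ n k a) ≡ p₁ ℕ.+ w₁ × toℕ (_⊛_ n k b) ≡ p₂ ℕ.+ w₂ × w₁ ℕ.+ w₂ ≡ t

    NeighbourCodeword : Set
    NeighbourCodeword = ∃ λ k →
      (toℕ (_⊛_ n k a) ≡ t × toℕ (_⊛_ n k b) ≡ suc t) ⊎ (toℕ (_⊛_ n k a) ≡ suc t × toℕ (_⊛_ n k b) ≡ t)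

    neighbour-codeword′ : ∀ k w₁ w₂ → w₁ ≤ 1 → toℕ (_⊛_ n k a) ≡ t ℕ.+ w₁ → toℕ (_⊛_ n k b) ≡ 1 ℕ.+ w₂ →
                          w₁ ℕ.+ w₂ ≡ t → NeighbourCodeword
    neighbour-codeword′ k 0 w₂ _ ka≡t+0 kb≡1+w₂ refl = k , inj₁ (trans ka≡t+0 (ℕ.+-identityʳ t) , kb≡1+w₂)
    neighbour-codeword′ k 1 w₂ _ ka≡t+1 kb≡1+w₂ refl = k , inj₂ (trans ka≡t+1 (ℕ.+-comm t 1) , kb≡1+w₂)
    neighbour-codeword′ k (suc (suc _)) _ (s≤s ()) _ _ _

    -- The determinant of two codewords vanishes.  For these two it is (2t+1) ((1 + w₁) - (t + w₁′)),
    -- and 2t+1 is invertible because (2t+1)² = 2n - 1; hence 1 + w₁ = t + w₁′, so w₁′ ≤ 1.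
    neighbour-codeword : CodewordBeyond 1 t → CodewordBeyond t 1 → NeighbourCodeword
    neighbour-codeword (k , w₁ , w₂ , ka≡ , kb≡ , w₁+w₂≡t) (k′ , w₁′ , w₂′ , k′a≡ , k′b≡ , w₁′+w₂′≡t) =
      neighbour-codeword′ k′ w₁′ w₂′ w₁′≤1 k′a≡ k′b≡ w₁′+w₂′≡t
      where
      W₁ = + w₁
      W₁′ = + w₁′
      complement : ∀ {u v} → u ℕ.+ v ≡ t → + v ≡ T - + u
      complement {u} {v} u+v≡t = trans (sym (cancel (+ u) (+ v))) (cong (λ s → + s - + u) u+v≡t)
        where
        cancel : ∀ u v → u + v - u ≡ v
        cancel = solve-∀
      det : (1ℤ + W₁) * (1ℤ + (T - W₁′)) ≈ (T + (T - W₁)) * (T + W₁′)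
      det = subst₂ _≈_ (cong₂ _*_ (cong +_ ka≡) (trans (cong +_ k′b≡) (cong (_+_ 1ℤ) (complement w₁′+w₂′≡t))))
                       (cong₂ _*_ (trans (cong +_ kb≡) (cong (_+_ T) (complement w₁+w₂≡t))) (cong +_ k′a≡))
                       (cross k k′)
      1+w₁≈t+w₁′ : + (1 ℕ.+ w₁) ≈ + (t ℕ.+ w₁′)
      1+w₁≈t+w₁′ = ≈-by-lincomb-N (- (+ 2 * T + 1ℤ)) (+ 2 * ((1ℤ + W₁) - (T + W₁′))) (identity T W₁ W₁′) det
        where
        identity : ∀ T w w′ → (1ℤ + w) - (T + w′) ≡
          - (+ 2 * T + 1ℤ) * ((1ℤ + w) * (1ℤ + (T - w′)) - (T + (T - w)) * (T + w′))
            + + 2 * ((1ℤ + w) - (T + w′)) * (1ℤ + + 2 * T * T + + 2 * T)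
        identity = solve-∀
      w₁′≤1 : w₁′ ≤ 1
      w₁′≤1 = ℕ.+-cancelˡ-≤ t w₁′ 1 (begin
        t ℕ.+ w₁′ ≡⟨ +-≈-injective (subst (_< n) ka≡ (Fin.toℕ<n _)) (subst (_< n) k′a≡ (Fin.toℕ<n _)) 1+w₁≈t+w₁′ ⟨
        1 ℕ.+ w₁  ≤⟨ ℕ.+-monoʳ-≤ 1 (subst (w₁ ≤_) w₁+w₂≡t (ℕ.m≤m+n w₁ w₂)) ⟩
        1 ℕ.+ t   ≡⟨ ℕ.+-comm 1 t ⟩
        t ℕ.+ 1   ∎)
        where open ℕ.≤-Reasoning

    -- Modulo n, t⁻¹ = -2 (t + 1) and (t + 1)⁻¹ = -2 t.  So (t , t + 1) in the code gives b ≡ 2t² a,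
    -- and (t + 1 , t) gives b ≡ (2t + 1) a; both multipliers square to -1.
    neighbour⇒multiplier : NeighbourCodeword → RotationMultiplier n a b
    neighbour⇒multiplier (k , inj₁ (ka≡t , kb≡1+t)) = record
      { c      = 2 ℕ.* t ℕ.* t
      ; b≈ca   = subst (λ C → ι b ≈ C * ι a) (sym 2t²≡)
                   (≈-by-lincomb-N (+ 2 * (T + 1ℤ)) (ι b - + 2 * ι a) (identity T (ι a) (ι b)) a[1+t]≈bt)
      ; c²+1≈0 = subst (λ C → C * C + 1ℤ ≈ 0ℤ) (sym 2t²≡) (≈-by-multiple-N (+ 2 * T * T - + 2 * T + 1ℤ) (square T))
      }
      where
      2t²≡ : + (2 ℕ.* t ℕ.* t) ≡ + 2 * T * T
      2t²≡ = trans (ℤ.pos-* (2 ℕ.* t) t) (cong (_* T) (ℤ.pos-* 2 t))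
      a[1+t]≈bt : ι a * (1ℤ + T) ≈ ι b * T
      a[1+t]≈bt = subst₂ (λ x y → ι a * x ≈ ι b * y) (cong +_ kb≡1+t) (cong +_ ka≡t) (proportional k)
      identity : ∀ T a b → b - + 2 * T * T * a ≡
        + 2 * (T + 1ℤ) * (a * (1ℤ + T) - b * T) + (b - + 2 * a) * (1ℤ + + 2 * T * T + + 2 * T)
      identity = solve-∀
      square : ∀ T → + 2 * T * T * (+ 2 * T * T) + 1ℤ - 0ℤ ≡ (+ 2 * T * T - + 2 * T + 1ℤ) * (1ℤ + + 2 * T * T + + 2 * T)
      square = solve-∀
    neighbour⇒multiplier (k , inj₂ (ka≡1+t , kb≡t)) = record
      { c      = 2 ℕ.* t ℕ.+ 1
      ; b≈ca   = subst (λ C → ι b ≈ C * ι a) (sym 2t+1≡)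
                   (≈-by-lincomb-N (+ 2 * T) (ι b - ι a) (identity T (ι a) (ι b)) at≈b[1+t])
      ; c²+1≈0 = subst (λ C → C * C + 1ℤ ≈ 0ℤ) (sym 2t+1≡) (≈-by-multiple-N (+ 2) (square T))
      }
      where
      2t+1≡ : + (2 ℕ.* t ℕ.+ 1) ≡ + 2 * T + 1ℤ
      2t+1≡ = trans (ℤ.pos-+ (2 ℕ.* t) 1) (cong (_+ 1ℤ) (ℤ.pos-* 2 t))
      at≈b[1+t] : ι a * T ≈ ι b * (1ℤ + T)
      at≈b[1+t] = subst₂ (λ x y → ι a * x ≈ ι b * y) (cong +_ kb≡t) (cong +_ ka≡1+t) (proportional k)
      identity : ∀ T a b → b - (+ 2 * T + 1ℤ) * a ≡
        + 2 * T * (a * T - b * (1ℤ + T)) + (b - a) * (1ℤ + + 2 * T * T + + 2 * T)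
      identity = solve-∀
      square : ∀ T → (+ 2 * T + 1ℤ) * (+ 2 * T + 1ℤ) + 1ℤ - 0ℤ ≡ + 2 * (1ℤ + + 2 * T * T + + 2 * T)
      square = solve-∀

    module _ (perfect : IsPerfectCode n t (InLinCode n a b)) where

      -- The point (p₁ , p₂) lies at distance t + 1 from the codeword 0, so the codeword covering it is not 0.
      codeword-beyond : ∀ {p₁ p₂} → 1 ≤ p₁ → 1 ≤ p₂ → p₁ ℕ.+ p₂ ≡ suc t → CodewordBeyond p₁ p₂
      codeword-beyond {p₁} {p₂} 1≤p₁ 1≤p₂ p₁+p₂≡1+t with proj₁ (proj₂ (proj₂ perfect)) (p₁ mod n , p₂ mod n)
      ... | c , (k , refl) , near =
        k , near-and-far⇒beyond t 1≤p₁ 1≤p₂ p₁+p₂≡1+t 2t+1<n _ _ near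
              (proj₁ perfect _ _ (k , refl) (zero , refl) c≢0)
        where
        wt-p : ∀ p q → 1 ≤ q → p ℕ.+ q ≡ suc t → wtL₁ n (_⊝_ n (p mod n) zero) ≡ p
        wt-p p q 1≤q p+q≡1+t = wtL₁-small _ (≈-trans (ι-⊝-zero (p mod n)) (ι-mod p)) (ℕ.≤-<-trans 2p≤2t+1 2t+1<n)
          where
          p≤t : p ≤ t
          p≤t = ℕ.+-cancelʳ-≤ 1 p t (subst (p ℕ.+ 1 ≤_) (trans p+q≡1+t (ℕ.+-comm 1 t)) (ℕ.+-monoʳ-≤ p 1≤q))
          2p≤2t+1 : p ℕ.+ p ≤ 2 ℕ.* t ℕ.+ 1
          2p≤2t+1 = ℕ.≤-trans (ℕ.+-mono-≤ p≤t p≤t) (subst (t ℕ.+ t ≤_) (regroup t) (ℕ.m≤m+n (t ℕ.+ t) 1))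
            where
            regroup : ∀ t → t ℕ.+ t ℕ.+ 1 ≡ 2 ℕ.* t ℕ.+ 1
            regroup = ℕ-Solver.solve-∀
        c≢0 : ¬ _·ᵖ_ n k (a , b) ≡ (zero , zero)
        c≢0 c≡0 = ℕ.<-irrefl refl (subst (_≤ t) dist≡1+t (subst (λ c → dL n (p₁ mod n , p₂ mod n) c ≤ t) c≡0 near))
          where
          dist≡1+t : dL n (p₁ mod n , p₂ mod n) (zero , zero) ≡ suc t
          dist≡1+t = trans (cong₂ ℕ._+_ (wt-p p₁ p₂ 1≤p₂ p₁+p₂≡1+t)
                                        (wt-p p₂ p₁ 1≤p₁ (trans (ℕ.+-comm p₂ p₁) p₁+p₂≡1+t)))
                           p₁+p₂≡1+t

      perfect⇒multiplier : RotationMultiplier n a b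
      perfect⇒multiplier = neighbour⇒multiplier
        (neighbour-codeword (codeword-beyond ℕ.≤-refl 1≤t refl) (codeword-beyond 1≤t ℕ.≤-refl (ℕ.+-comm t 1)))

-- The generators of G_S as maps on positions

module Positions (n : ℕ) .{{_ : NonZero n}} where
  open import Data.Integer using (_+_; _-_; _*_)
  open Congruence n

  shift : ℕ → Zn n → Zn n
  shift k u = iterate (λ v → _⊝_ n v (one n)) u k

  ι-shift : ∀ k {u x} → ι u ≈ x → ι (shift k u) ≈ x - + k
  ι-shift zero    {x = x} u≈x = ≈-trans u≈x (≈-reflexive (sym (ℤ.+-identityʳ x)))
  ι-shift (suc k) {u} {x} u≈x =
    ≈-trans (ι-shift k (≈-trans (ι-⊝-one u) (+-cong u≈x ≈-refl))) (≈-reflexive (regroup x (+ k)))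
    where
    regroup : ∀ x k → x - 1ℤ - k ≡ x - (1ℤ + k)
    regroup = solve-∀

  flip : Zn n → Zn n
  flip u = (n ℕ.∸ 1 ℕ.∸ toℕ u) mod n

  ι-flip : ∀ {u x} → ι u ≈ x → ι (flip u) ≈ - 1ℤ - x
  ι-flip {u} {x} u≈x = begin
    ι (flip u)                  ≈⟨ ι-mod (n ℕ.∸ 1 ℕ.∸ toℕ u) ⟩
    + (n ℕ.∸ 1 ℕ.∸ toℕ u)       ≡⟨ cong +_ (ℕ.∸-+-assoc n 1 (toℕ u)) ⟩
    + (n ℕ.∸ suc (toℕ u))       ≡⟨ pos-∸ (Fin.toℕ<n u) ⟩
    + n - (1ℤ + ι u)            ≈⟨ +-cong n≈0 (-‿cong (+-cong (≈-refl {1ℤ}) u≈x)) ⟩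
    0ℤ - (1ℤ + x)               ≡⟨ regroup x ⟩
    - 1ℤ - x                    ∎
    where
    open ≈-Reasoning
    regroup : ∀ x → 0ℤ - (1ℤ + x) ≡ - 1ℤ - x
    regroup = solve-∀

  Pos : Set
  Pos = Pt n

  infix 4 _≈²_
  _≈²_ : ℤ × ℤ → ℤ × ℤ → Set
  v ≈² w = proj₁ v ≈ proj₁ w × proj₂ v ≈ proj₂ w

  ≈²-reflexive : ∀ {v w} → v ≡ w → v ≈² w
  ≈²-reflexive refl = ≈-refl , ≈-refl

  ≈²-trans : ∀ {u v w} → u ≈² v → v ≈² w → u ≈² w
  ≈²-trans (p₁ , p₂) (q₁ , q₂) = ≈-trans p₁ q₁ , ≈-trans p₂ q₂

  ≈²-sym : ∀ {v w} → v ≈² w → w ≈² v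
  ≈²-sym (p₁ , p₂) = ≈-sym p₁ , ≈-sym p₂

  ι² : Pos → ℤ × ℤ
  ι² (i , j) = ι i , ι j

  ι²-injective : ∀ {p q} → ι² p ≈² ι² q → p ≡ q
  ι²-injective (e₁ , e₂) = cong₂ _,_ (ι-injective e₁) (ι-injective e₂)

  -- Identities between position maps are proved on integer models of the maps.
  Tracks : (Pos → Pos) → (ℤ × ℤ → ℤ × ℤ) → Set
  Tracks φ Φ = ∀ {p v} → ι² p ≈² v → ι² (φ p) ≈² Φ v

  tracks-∘ : ∀ {φ ψ Φ Ψ} → Tracks φ Φ → Tracks ψ Ψ → Tracks (φ ∘ ψ) (Φ ∘ Ψ)
  tracks-∘ φ∼Φ ψ∼Ψ = φ∼Φ ∘ ψ∼Ψ

  tracks-≡ : ∀ {φ ψ Φ Ψ} → Tracks φ Φ → Tracks ψ Ψ → (∀ v → Φ v ≈² Ψ v) → ∀ p → φ p ≡ ψ p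
  tracks-≡ φ∼Φ ψ∼Ψ Φ≈Ψ p =
    ι²-injective (≈²-trans (φ∼Φ refl²) (≈²-trans (Φ≈Ψ (ι² p)) (≈²-sym (ψ∼Ψ refl²))))
    where
    refl² : ι² p ≈² ι² p
    refl² = ≈-refl , ≈-refl

module Arrays (n : ℕ) .{{_ : NonZero n}} where
  open Positions n

  ∼-refl : ∀ {A} → _∼_ n A A
  ∼-refl = ↔-refl , λ _ _ → refl

  ∼-sym : ∀ {A B} → _∼_ n A B → _∼_ n B A
  ∼-sym {A} (σ , σA≡B) =
    ↔-sym σ , λ i j → trans (cong (Inverse.from σ) (sym (σA≡B i j))) (Inverse.strictlyInverseʳ σ (A i j))

  ∼-trans : ∀ {A B C} → _∼_ n A B → _∼_ n B C → _∼_ n A C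
  ∼-trans (σ , σA≡B) (τ , τB≡C) = ↔-trans σ τ , λ i j → trans (cong (Inverse.to τ) (σA≡B i j)) (τB≡C i j)

  ≗ᴬ⇒∼ : ∀ {A B} → _≗ᴬ_ n A B → _∼_ n A B
  ≗ᴬ⇒∼ A≗B = ↔-refl , A≗B

  relabelling-setoid : Setoid 0ℓ 0ℓ
  relabelling-setoid = record
    { Carrier = Array n
    ; _≈_ = _∼_ n
    ; isEquivalence = record { refl = ∼-refl ; sym = ∼-sym ; trans = ∼-trans }
    }

  module ∼-Reasoning = SetoidReasoning relabelling-setoid

  reindex : (Pos → Pos) → Array n → Array n
  reindex φ A i j = uncurry A (φ (i , j))

  reindex-∼ : ∀ φ {A B} → _∼_ n A B → _∼_ n (reindex φ A) (reindex φ B)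
  reindex-∼ φ (σ , σA≡B) = σ , λ i j → uncurry σA≡B (φ (i , j))

  reindex-∼⁻¹ : ∀ {φ} → StrictlySurjective _≡_ φ → ∀ {A B} → _∼_ n (reindex φ A) (reindex φ B) → _∼_ n A B
  reindex-∼⁻¹ {φ} φ-onto {A} {B} (σ , σAφ≡Bφ) = σ , λ i j → onto i j (φ-onto (i , j))
    where
    onto : ∀ i j → ∃ (λ p → φ p ≡ (i , j)) → Inverse.to σ (A i j) ≡ B i j
    onto i j ((k , l) , refl) = σAφ≡Bφ k l

  pow-τ₁ : ∀ k A i j → pow n (τ₁ n) k A i j ≡ A (shift k i) j
  pow-τ₁ zero    A i j = refl
  pow-τ₁ (suc k) A i j = pow-τ₁ k A (_⊝_ n i (one n)) j

  pow-τ₂ : ∀ k A i j → pow n (τ₂ n) k A i j ≡ A i (shift k j)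
  pow-τ₂ zero    A i j = refl
  pow-τ₂ (suc k) A i j = pow-τ₂ k A i (_⊝_ n j (one n))

module Generators (n : ℕ) .{{_ : NonZero n}} (a b x₁ x₂ : Zn n) where
  open import Data.Integer using (_+_; _-_; _*_)
  open Congruence n
  open Positions n
  open Arrays n

  K L : ℕ
  K = toℕ (_⊕_ n (_⊕_ n x₁ x₂) (one n))
  L = toℕ (_⊝_ n x₁ x₂)

  ρ τ : Pos → Pos
  ρ (i , j) = flip (shift K j) , shift L i
  τ (i , j) = shift (toℕ a) i , shift (toℕ b) j

  ρ-tracks : Tracks ρ (λ (x , y) → - 1ℤ - (y - + K) , x - + L)
  ρ-tracks (x≈ , y≈) = ι-flip (ι-shift K y≈) , ι-shift L x≈

  τ^-tracks : ∀ m → Tracks (λ p → iterate τ p m) (λ (x , y) → x - + m * ι a , y - + m * ι b)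
  τ^-tracks zero {v = x , y} (x≈ , y≈) =
    ≈-trans x≈ (≈-reflexive (sym (ℤ.+-identityʳ x))) , ≈-trans y≈ (≈-reflexive (sym (ℤ.+-identityʳ y)))
  τ^-tracks (suc m) {v = x , y} (x≈ , y≈) =
    ≈²-trans (τ^-tracks m (ι-shift (toℕ a) x≈ , ι-shift (toℕ b) y≈))
             (≈²-reflexive (cong₂ _,_ (regroup x (+ m) (ι a)) (regroup y (+ m) (ι b))))
    where
    regroup : ∀ x m a → x - a - m * a ≡ x - (1ℤ + m) * a
    regroup = solve-∀

  ρ⁴≡id : ∀ p → iterate ρ p 4 ≡ p
  ρ⁴≡id = tracks-≡ {Ψ = id} (tracks-∘ ρ-tracks (tracks-∘ ρ-tracks (tracks-∘ ρ-tracks ρ-tracks))) id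
            (λ (x , y) → ≈²-reflexive (cong₂ _,_ (first x (+ K) (+ L)) (second y (+ K) (+ L))))
    where
    first : ∀ x K L → - 1ℤ - (((- 1ℤ - ((x - L) - K)) - L) - K) ≡ x
    first = solve-∀
    second : ∀ y K L → (- 1ℤ - (((- 1ℤ - (y - K)) - L) - K)) - L ≡ y
    second = solve-∀

  τ^-cong : ∀ {k l} → + k ≈ + l → ∀ p → iterate τ p k ≡ iterate τ p l
  τ^-cong {k} {l} k≈l = tracks-≡ (τ^-tracks k) (τ^-tracks l)
    (λ (x , y) → +-cong (≈-refl {x}) (-‿cong (*-cong k≈l ≈-refl)) ,
                 +-cong (≈-refl {y}) (-‿cong (*-cong k≈l ≈-refl)))

  τ^-ρ : ∀ c → - ι a ≈ + c * ι b → ι b ≈ + c * ι a → ∀ m p → iterate τ (ρ p) m ≡ ρ (iterate τ p (c ℕ.* m))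
  τ^-ρ c -a≈cb b≈ca m = tracks-≡ (tracks-∘ (τ^-tracks m) ρ-tracks) (tracks-∘ ρ-tracks (τ^-tracks (c ℕ.* m)))
    (λ (x , y) → first y , second x)
    where
    A = ι a
    B = ι b
    cm≡c*m : + (c ℕ.* m) ≡ + c * + m
    cm≡c*m = ℤ.pos-* c m
    first : ∀ y → (- 1ℤ - (y - + K)) - + m * A ≈ - 1ℤ - ((y - + (c ℕ.* m) * B) - + K)
    first y = ≈-by-scaling (+ m)
      (trans (cong (λ cm → (- 1ℤ - (y - + K)) - + m * A - (- 1ℤ - ((y - cm * B) - + K))) cm≡c*m)
             (identity (+ K) y (+ m) (+ c) A B)) -a≈cb
      where
      identity : ∀ K y m c A B → (- 1ℤ - (y - K)) - m * A - (- 1ℤ - ((y - c * m * B) - K)) ≡ m * (- A - c * B)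
      identity = solve-∀
    second : ∀ x → (x - + L) - + m * B ≈ (x - + (c ℕ.* m) * A) - + L
    second x = ≈-by-scaling (- + m)
      (trans (cong (λ cm → (x - + L) - + m * B - ((x - cm * A) - + L)) cm≡c*m)
             (identity (+ L) x (+ m) (+ c) A B)) b≈ca
      where
      identity : ∀ L x m c A B → (x - L) - m * B - ((x - c * m * A) - L) ≡ - m * (B - c * A)
      identity = solve-∀

  gen₁≗reindex : ∀ A → _≗ᴬ_ n (gen₁ n x₁ x₂ A) (reindex ρ A)
  gen₁≗reindex A i j = trans (pow-τ₂ K _ i j) (pow-τ₁ L (rot n A) i (shift K j))

  gen₂≗reindex : ∀ A → _≗ᴬ_ n (gen₂ n a b A) (reindex τ A)
  gen₂≗reindex A i j = trans (pow-τ₁ (toℕ a) _ i j) (pow-τ₂ (toℕ b) A (shift (toℕ a) i) j)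

-- The action of G_S on relabelling classes

next : Fin 4 → Fin 4
next 0F = 1F
next 1F = 2F
next 2F = 3F
next 3F = 0F

module Action (n : ℕ) .{{_ : NonZero n}} (a b x₁ x₂ : Zn n) (multiplier : RotationMultiplier n a b) where
  open import Data.Integer using (_+_; _-_; _*_)
  open Congruence n
  open RotationMultiplier multiplier
  open Positions n
  open Arrays n
  open Generators n a b x₁ x₂

  -a≈cb : - ι a ≈ + c * ι b
  -a≈cb = ≈-sym (≈-trans (*-cong (≈-refl {+ c}) b≈ca) (≈-by-scaling (ι a) (identity (+ c) (ι a)) c²+1≈0))
    where
    identity : ∀ c a → c * (c * a) - - a ≡ a * ((c * c + 1ℤ) - 0ℤ)
    identity = solve-∀

  Index : Set
  Index = Fin 4 × Zn n

  -- ψ (k , m) is the position map of the element (second generator)ᵐ (first generator)ᵏ of G_S.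
  ψ : Index → Pos → Pos
  ψ (k , m) p = iterate ρ (iterate τ p (toℕ m)) (toℕ k)

  act : Index → Array n → Array n
  act h = reindex (ψ h)

  c′ : Zn n
  c′ = c mod n

  ι-c′⊛ : ∀ u → ι (_⊛_ n c′ u) ≈ + c * ι u
  ι-c′⊛ u = ≈-trans (ι-⊛ c′ u) (*-cong (ι-mod c) ≈-refl)

  λ₁ λ₂ λ₂⁻¹ : Index → Index
  λ₁ (k , m) = next k , _⊛_ n c′ m
  λ₂ (k , m) = k , _⊕_ n m (one n)
  λ₂⁻¹ (k , m) = k , _⊝_ n m (one n)

  ρ-next : ∀ k p → iterate ρ p (toℕ (next k)) ≡ iterate ρ (ρ p) (toℕ k)
  ρ-next 0F p = refl
  ρ-next 1F p = refl
  ρ-next 2F p = refl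
  ρ-next 3F p = sym (ρ⁴≡id p)

  ψ-λ₁ : ∀ h p → ψ (λ₁ h) p ≡ ψ h (ρ p)
  ψ-λ₁ (k , m) p = begin
    iterate ρ (iterate τ p (toℕ (_⊛_ n c′ m))) (toℕ (next k))
      ≡⟨ cong (λ q → iterate ρ q (toℕ (next k))) (τ^-cong cm≈ p) ⟨
    iterate ρ (iterate τ p (c ℕ.* toℕ m)) (toℕ (next k))
      ≡⟨ ρ-next k _ ⟩
    iterate ρ (ρ (iterate τ p (c ℕ.* toℕ m))) (toℕ k)
      ≡⟨ cong (λ q → iterate ρ q (toℕ k)) (τ^-ρ c -a≈cb b≈ca (toℕ m) p) ⟨
    iterate ρ (iterate τ (ρ p) (toℕ m)) (toℕ k)
      ∎
    where
    open ≡-Reasoning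
    cm≈ : + (c ℕ.* toℕ m) ≈ ι (_⊛_ n c′ m)
    cm≈ = ≈-sym (≈-trans (ι-c′⊛ m) (≈-reflexive (sym (ℤ.pos-* c (toℕ m)))))

  ψ-λ₂ : ∀ h p → ψ (λ₂ h) p ≡ ψ h (τ p)
  ψ-λ₂ (k , m) p = cong (λ q → iterate ρ q (toℕ k)) (τ^-cong ι-m⊕1 p)
    where
    ι-m⊕1 : ι (_⊕_ n m (one n)) ≈ + suc (toℕ m)
    ι-m⊕1 = ≈-trans (ι-⊕-one m) (≈-reflexive (ℤ.+-comm (ι m) 1ℤ))

  ι-c′⊛-iterate : ∀ k u → ι (iterate (_⊛_ n c′) u k) ≈ (+ c) ℤ.^ k * ι u
  ι-c′⊛-iterate zero    u = ≈-reflexive (sym (ℤ.*-identityˡ (ι u)))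
  ι-c′⊛-iterate (suc k) u = begin
    ι (iterate (_⊛_ n c′) (_⊛_ n c′ u) k) ≈⟨ ι-c′⊛-iterate k (_⊛_ n c′ u) ⟩
    (+ c) ℤ.^ k * ι (_⊛_ n c′ u)         ≈⟨ *-cong (≈-refl {(+ c) ℤ.^ k}) (ι-c′⊛ u) ⟩
    (+ c) ℤ.^ k * (+ c * ι u)            ≡⟨ regroup (+ c) ((+ c) ℤ.^ k) (ι u) ⟩
    + c * (+ c) ℤ.^ k * ι u              ∎
    where
    open ≈-Reasoning
    regroup : ∀ c cᵏ u → cᵏ * (c * u) ≡ c * cᵏ * u
    regroup = solve-∀

  λ₁⁴≡id : ∀ h → λ₁ (λ₁ (λ₁ (λ₁ h))) ≡ h
  λ₁⁴≡id (k , m) = cong₂ _,_ (next⁴ k) (ι-injective (≈-trans (ι-c′⊛-iterate 4 m)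
    (≈-by-scaling ((+ c * + c - 1ℤ) * ι m) (identity (+ c) (ι m)) c²+1≈0)))
    where
    next⁴ : ∀ k → next (next (next (next k))) ≡ k
    next⁴ 0F = refl
    next⁴ 1F = refl
    next⁴ 2F = refl
    next⁴ 3F = refl
    identity : ∀ c u → c * (c * (c * (c * 1ℤ))) * u - u ≡ (c * c - 1ℤ) * u * ((c * c + 1ℤ) - 0ℤ)
    identity = solve-∀

  λ₂-λ₂⁻¹ : ∀ h → λ₂ (λ₂⁻¹ h) ≡ h
  λ₂-λ₂⁻¹ (k , m) = cong (k ,_) (ι-injective
    (≈-trans (ι-⊕-one _) (≈-trans (+-cong (ι-⊝-one m) (≈-refl {1ℤ})) (≈-reflexive (cancel (ι m))))))
    where
    cancel : ∀ u → u - 1ℤ + 1ℤ ≡ u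
    cancel = solve-∀

  λ₂⁻¹-λ₂ : ∀ h → λ₂⁻¹ (λ₂ h) ≡ h
  λ₂⁻¹-λ₂ (k , m) = cong (k ,_) (ι-injective
    (≈-trans (ι-⊝-one _) (≈-trans (+-cong (ι-⊕-one m) (≈-refl { - 1ℤ})) (≈-reflexive (cancel (ι m))))))
    where
    cancel : ∀ u → u + 1ℤ - 1ℤ ≡ u
    cancel = solve-∀

  λ₁↔ λ₂↔ : Index ↔ Index
  λ₁↔ = mk↔ₛ′ λ₁ (λ₁ ∘ λ₁ ∘ λ₁) λ₁⁴≡id λ₁⁴≡id
  λ₂↔ = mk↔ₛ′ λ₂ λ₂⁻¹ λ₂-λ₂⁻¹ λ₂⁻¹-λ₂

  left-mul : Index → Index ↔ Index
  left-mul (k , m) = ↔-trans (↔-iterate λ₁↔ (toℕ k)) (↔-iterate λ₂↔ (toℕ m))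

  ψ-iterate : ∀ e φ → (∀ h p → ψ (Inverse.to e h) p ≡ ψ h (φ p)) →
              ∀ k h p → ψ (Inverse.to (↔-iterate e k) h) p ≡ ψ h (iterate φ p k)
  ψ-iterate e φ ψ-e zero    h p = refl
  ψ-iterate e φ ψ-e (suc k) h p = trans (ψ-e _ p) (ψ-iterate e φ ψ-e k h (φ p))

  ψ-left-mul : ∀ h h′ p → ψ (Inverse.to (left-mul h) h′) p ≡ ψ h′ (ψ h p)
  ψ-left-mul (k , m) h′ p = trans (ψ-iterate λ₂↔ τ ψ-λ₂ (toℕ m) _ p) (ψ-iterate λ₁↔ ρ ψ-λ₁ (toℕ k) h′ _)

  e₀ : Index
  e₀ = 0F , 0 mod n

  ψ-e₀ : ∀ p → ψ e₀ p ≡ p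
  ψ-e₀ = τ^-cong (ι-mod 0)

  ρ-surjective : StrictlySurjective _≡_ ρ
  ρ-surjective p = iterate ρ p 3 , ρ⁴≡id p

  τ-surjective : StrictlySurjective _≡_ τ
  τ-surjective p = iterate τ p (ℕ.pred n) , trans (iterate-comm τ p (ℕ.pred n)) (τ^-cong n≈0′ p)
    where
    n≈0′ : + suc (ℕ.pred n) ≈ + 0
    n≈0′ = subst (λ k → + k ≈ + 0) (sym (ℕ.suc-pred n)) n≈0

  ψ-surjective : ∀ h → StrictlySurjective _≡_ (ψ h)
  ψ-surjective (k , m) p =
    proj₁ τᵐ-onto , trans (cong (λ q → iterate ρ q (toℕ k)) (proj₂ τᵐ-onto)) (proj₂ ρᵏ-onto)
    where
    ρᵏ-onto = iterate-surjective ρ-surjective (toℕ k) p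
    τᵐ-onto = iterate-surjective τ-surjective (toℕ m) (proj₁ ρᵏ-onto)

  module Step {g : Array n → Array n} {φ : Pos → Pos} (g≗reindex : ∀ A → _≗ᴬ_ n (g A) (reindex φ A))
              (φ-surjective : StrictlySurjective _≡_ φ)
              (e : Index ↔ Index) (ψ-e : ∀ h p → ψ (Inverse.to e h) p ≡ ψ h (φ p)) {A : Array n} where
    open ∼-Reasoning

    reindex-act : ∀ h → _≗ᴬ_ n (reindex φ (act h A)) (act (Inverse.to e h) A)
    reindex-act h i j = cong (uncurry A) (sym (ψ-e h (i , j)))

    forward : ∀ {T U} → _≗ᴬ_ n (g T) U → ∀ h → _∼_ n T (act h A) → _∼_ n U (act (Inverse.to e h) A)
    forward {T} {U} gT≗U h T∼hA = begin
      U                         ≈⟨ ≗ᴬ⇒∼ gT≗U ⟨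
      g T                       ≈⟨ ≗ᴬ⇒∼ (g≗reindex T) ⟩
      reindex φ T               ≈⟨ reindex-∼ φ T∼hA ⟩
      reindex φ (act h A)       ≈⟨ ≗ᴬ⇒∼ (reindex-act h) ⟩
      act (Inverse.to e h) A    ∎

    backward : ∀ {T U} → _≗ᴬ_ n (g U) T → ∀ h → _∼_ n T (act h A) → _∼_ n U (act (Inverse.from e h) A)
    backward {T} {U} gU≗T h T∼hA = reindex-∼⁻¹ φ-surjective (begin
      reindex φ U                                ≈⟨ ≗ᴬ⇒∼ (g≗reindex U) ⟨
      g U                                        ≈⟨ ≗ᴬ⇒∼ gU≗T ⟩
      T                                          ≈⟨ T∼hA ⟩
      act h A                                    ≡⟨ cong (λ h′ → act h′ A) (Inverse.strictlyInverseˡ e h) ⟨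
      act (Inverse.to e (Inverse.from e h)) A    ≈⟨ ≗ᴬ⇒∼ (reindex-act (Inverse.from e h)) ⟨
      reindex φ (act (Inverse.from e h) A)       ∎)

  module _ (S : Array n) where
    module Step₁ = Step gen₁≗reindex ρ-surjective λ₁↔ ψ-λ₁ {S}
    module Step₂ = Step gen₂≗reindex τ-surjective λ₂↔ ψ-λ₂ {S}

    reach⇒act : ∀ {U} → Reach n a b x₁ x₂ S U → ∃ λ h → _∼_ n U (act h S)
    reach⇒act (here S≗U)     = e₀ , ≗ᴬ⇒∼ λ i j → trans (sym (S≗U i j)) (cong (uncurry S) (sym (ψ-e₀ (i , j))))
    reach⇒act (fwd₁ r g₁T≗U) = let h , T∼hS = reach⇒act r in Inverse.to   λ₁↔ h , Step₁.forward  g₁T≗U h T∼hS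
    reach⇒act (fwd₂ r g₂T≗U) = let h , T∼hS = reach⇒act r in Inverse.to   λ₂↔ h , Step₂.forward  g₂T≗U h T∼hS
    reach⇒act (inv₁ r g₁U≗T) = let h , T∼hS = reach⇒act r in Inverse.from λ₁↔ h , Step₁.backward g₁U≗T h T∼hS
    reach⇒act (inv₂ r g₂U≗T) = let h , T∼hS = reach⇒act r in Inverse.from λ₂↔ h , Step₂.backward g₂U≗T h T∼hS

    reach-ρ^ : ∀ k → Reach n a b x₁ x₂ S (reindex (λ p → iterate ρ p k) S)
    reach-ρ^ zero    = here λ i j → refl
    reach-ρ^ (suc k) = fwd₁ (reach-ρ^ k) (gen₁≗reindex (reindex (λ p → iterate ρ p k) S))

    reach-τ^ : ∀ m {B} → Reach n a b x₁ x₂ S B → Reach n a b x₁ x₂ S (reindex (λ p → iterate τ p m) B)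
    reach-τ^ zero    r = r
    reach-τ^ (suc m) {B} r = fwd₂ (reach-τ^ m r) (gen₂≗reindex (reindex (λ p → iterate τ p m) B))

    act-reachable : ∀ h → Reach n a b x₁ x₂ S (act h S)
    act-reachable (k , m) = reach-τ^ (toℕ m) (reach-ρ^ (toℕ k))

  orbit-length-∣-4n : ∀ S L → IsOrbitReps n a b x₁ x₂ S L → length L ∣ 4 ℕ.* n
  orbit-length-∣-4n S L (L⊆orbit , L-distinct , orbit⊆L) =
    OrbitCounting.orbit-length-∣ relabelling-setoid (↔-sym Fin.*↔×) act
      (λ h → reindex-∼ (ψ h)) (λ h → reindex-∼⁻¹ (ψ-surjective h))
      S e₀ (≗ᴬ⇒∼ λ i j → cong (uncurry S) (ψ-e₀ (i , j)))
      left-mul (λ h h′ → ≗ᴬ⇒∼ λ i j → cong (uncurry S) (ψ-left-mul h h′ (i , j)))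
      L (All.map (λ (U , reach , T∼U) → map id (∼-trans T∼U) (reach⇒act S reach)) L⊆orbit)
      L-distinct
      (λ h → orbit⊆L (act h S) (act h S , act-reachable S h , ∼-refl))

open import Data.Nat using (_+_; _*_)

theorem8 : (t : ℕ) → 1 ≤ t →
    let n = 1 + 2 * t * t + 2 * t in
    (a b x₁ x₂ : Zn n) →
    IsPerfectCode n t (InLinCode n a b) →
    (S : Array n) → IsPerfectSudoku n t a b (x₁ , x₂) S →
    (L : List (Array n)) → IsOrbitReps n a b x₁ x₂ S L →
    length L ∣ 4 * n
theorem8 t 1≤t a b x₁ x₂ perfect S _ =
  Action.orbit-length-∣-4n _ a b x₁ x₂ (Classification.perfect⇒multiplier t 1≤t a b perfect) S
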